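{- Let $P$ be a normal logic program and $I$ a three-valued interpretation of $P$. Then $I$ is an L-stable model of $P$ if and only if $I$ is a $\le_u$-minimal stable trap space of $P$, i.e., $I$ is a stable trap space and there is no stable trap space $J$ with $J^{\mathbf{u}}\subsetneq I^{\mathbf{u}}$.
   Context: Fix a first-order language with finitely many constant, function and predicate symbols. A normal logic program (NLP) $P$ is a finite set of rules $p \leftarrow p_1,\dots,p_m, \mathord{\sim} p_{m+1},\dots,\mathord{\sim} p_k$ ($k\ge m\ge 0$). $\mathrm{HB}(P)$ is its Herbrand base (possibly infinite), $\mathrm{gr}(P)$ its ground instantiation; for a ground rule $r$: head $\mathrm{head}(r)$, positive/negative body atoms $B^+(r)$, $B^-(r)$, $\mathrm{bf}(r)=\bigwedge_{v\in B^+(r)}v\wedge\bigwedge_{v\in B^-(r)}\neg v$. A three-valued interpretation is a map $I:\mathrm{HB}(P)\to\{0,1,\star\}$; two-valued ones are identified with subsets of $\mathrm{HB}(P)$. $[I]=\{J\subseteq\mathrm{HB}(P): \forall a,\ I(a)\ne\star\Rightarrow J(a)=I(a)\}$; $I^{\mathbf{u}}=\{a\in\mathrm{HB}(P): I(a)=\star\}$. The preorder $\le_u$: $I_1\le_u I_2$ iff $I_1^{\mathbf{u}}\subseteq I_2^{\mathbf{u}}$. Order $\le_t$: $0<_t\star<_t1$; Kleene evaluation ($\neg\star=\star$, $\wedge$ = $\le_t$-min). $I$ is a three-valued model of a program if $I(\mathrm{bf}(r))\le_t I(\mathrm{head}(r))$ for each ground rule. The reduct $P^I$: from $\mathrm{gr}(P)$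 delete every rule with some $b\in B^-(r)$, $I(b)=1$; delete each $\mathord{\sim}b$ with $I(b)=0$; replace each remaining $\mathord{\sim}b$ by a special atom $\mathbf{u}$ always valued $\star$. $P^I$ has a unique $\le_t$-least three-valued model; $I$ is a stable partial model if it equals it. $I$ is an L-stable model if it is a stable partial model and no stable partial model $J$ has $J^{\mathbf{u}}\subsetneq I^{\mathbf{u}}$. For two-valued $I$, $F_P(I)$ is the $\subseteq$-least model of the Gelfond–Lifschitz reduct (delete rules with some $b\in B^-(r)\cap I$, then delete remaining negative literals). A nonempty set $S$ of two-valued interpretations is a stable trap set if $\{F_P(J):J\in S\}\subseteq S$; a three-valued $I$ is a stable trap space if $[I]$ is a stable trap set. -}

module Defs where

open import Data.Nat using (ℕ; zero; suc; _≤_)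
open import Data.Fin using (Fin)
open import Data.Vec using (Vec; []; _∷_)
open import Data.List using (List; []; _∷_; map; _++_; filterᵇ; foldr)
open import Data.Bool.ListAction using (any)
open import Data.List.Membership.Propositional using (_∈_)
open import Data.List.Relation.Unary.All using (All)
open import Data.Bool using (Bool; true; false; if_then_else_)
open import Data.Maybe using (Maybe; just; nothing)
open import Data.Product using (Σ; _×_; _,_)
open import Relation.Binary.PropositionalEquality using (_≡_)
open import Relation.Nullary using (¬_)

record Signature : Set where
  field
    nConst : ℕ
    nFun   : ℕ
    funAr  : Fin nFun → ℕ
    nPred  : ℕ
    predAr : Fin nPred → ℕ
open Signature public

data Term (S : Signature) (k : ℕ) : Set where
  var : Fin k → Term S k
  con : Fin (nConst S) → Term S k
  app : (f : Fin (nFun S)) → Vec (Term S k) (funAr S f) → Term S k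

GTerm : Signature → Set
GTerm S = Term S 0

record Atom (S : Signature) (k : ℕ) : Set where
  constructor atom
  field
    pred : Fin (nPred S)
    args : Vec (Term S k) (predAr S pred)
open Atom public

GAtom : Signature → Set
GAtom S = Atom S 0

record Rule (S : Signature) : Set where
  field
    nv   : ℕ
    head : Atom S nv
    pos  : List (Atom S nv)
    neg  : List (Atom S nv)
open Rule public

Program : Signature → Set
Program S = List (Rule S)

mutual
  substT : ∀ {S k} → (Fin k → GTerm S) → Term S k → GTerm S
  substT σ (var x) = σ x
  substT σ (con c) = con c
  substT σ (app f ts) = app f (substV σ ts)

  substV : ∀ {S k n} → (Fin k → GTerm S) → Vec (Term S k) n → Vec (GTerm S) n
  substV σ [] = []
  substV σ (t ∷ ts) = substT σ t ∷ substV σ ts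

substA : ∀ {S k} → (Fin k → GTerm S) → Atom S k → GAtom S
substA σ (atom p ts) = atom p (substV σ ts)

record GroundRule (S : Signature) : Set where
  constructor gRule
  field
    gHead : GAtom S
    gPos  : List (GAtom S)
    gNeg  : List (GAtom S)
open GroundRule public

inst : ∀ {S} (r : Rule S) → (Fin (nv r) → GTerm S) → GroundRule S
inst r σ = gRule (substA σ (head r)) (map (substA σ) (pos r)) (map (substA σ) (neg r))

InGr : ∀ {S} → Program S → GroundRule S → Set
InGr {S} P g = Σ (Rule S) λ r → r ∈ P × Σ (Fin (nv r) → GTerm S) λ σ → inst r σ ≡ g

data V3 : Set where
  𝟘 ⋆ 𝟙 : V3

rank : V3 → ℕ
rank 𝟘 = 0
rank ⋆ = 1
rank 𝟙 = 2

_≤t_ : V3 → V3 → Set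
a ≤t b = rank a ≤ rank b

_∧₃_ : V3 → V3 → V3
𝟘 ∧₃ b = 𝟘
⋆ ∧₃ 𝟘 = 𝟘
⋆ ∧₃ b = ⋆
𝟙 ∧₃ b = b

isOne isStar : V3 → Bool
isOne 𝟙 = true
isOne _ = false
isStar ⋆ = true
isStar _ = false

Interp3 : Signature → Set
Interp3 S = GAtom S → V3

Interp2 : Signature → Set
Interp2 S = GAtom S → Bool

data BodyElem (S : Signature) : Set where
  atm : GAtom S → BodyElem S
  𝐮   : BodyElem S      -- the special atom u, always valued ⋆

record RRule (S : Signature) : Set where
  constructor rRule
  field
    rHead : GAtom S
    rBody : List (BodyElem S)
open RRule public

reductRule : ∀ {S} → Interp3 S → GroundRule S → Maybe (RRule S)
reductRule I g =
  if any (λ b → isOne (I b)) (gNeg g) then nothing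
  else just (rRule (gHead g)
                   (map atm (gPos g) ++ map (λ _ → 𝐮) (filterᵇ (λ b → isStar (I b)) (gNeg g))))

InReduct : ∀ {S} → Program S → Interp3 S → RRule S → Set
InReduct {S} P I rr = Σ (GroundRule S) λ g → InGr P g × reductRule I g ≡ just rr

evalElem : ∀ {S} → Interp3 S → BodyElem S → V3
evalElem J (atm a) = J a
evalElem J 𝐮 = ⋆

evalBody : ∀ {S} → Interp3 S → List (BodyElem S) → V3
evalBody J = foldr (λ e v → evalElem J e ∧₃ v) 𝟙

Model3 : ∀ {S} → Program S → Interp3 S → Interp3 S → Set
Model3 P I J = ∀ rr → InReduct P I rr → evalBody J (rBody rr) ≤t J (rHead rr)

LeastModel3 : ∀ {S} → Program S → Interp3 S → Interp3 S → Set
LeastModel3 {S} P I J = Model3 P I J × (∀ (M : Interp3 S) → Model3 P I M → ∀ a → J a ≤t M a)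

StablePartial : ∀ {S} → Program S → Interp3 S → Set
StablePartial P I = LeastModel3 P I I

USub : ∀ {S} → Interp3 S → Interp3 S → Set
USub J I = ∀ a → J a ≡ ⋆ → I a ≡ ⋆

UStrict : ∀ {S} → Interp3 S → Interp3 S → Set
UStrict J I = USub J I × ¬ USub I J

LStable : ∀ {S} → Program S → Interp3 S → Set
LStable {S} P I = StablePartial P I × ¬ (Σ (Interp3 S) λ J → StablePartial P J × UStrict J I)

record GLRule (S : Signature) : Set where
  constructor glRule
  field
    glHead : GAtom S
    glPos  : List (GAtom S)
open GLRule public

glReductRule : ∀ {S} → Interp2 S → GroundRule S → Maybe (GLRule S)
glReductRule J g = if any J (gNeg g) then nothing else just (glRule (gHead g) (gPos g))

InGL : ∀ {S} → Program S → Interp2 S → GLRule S → Set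
InGL {S} P J rr = Σ (GroundRule S) λ g → InGr P g × glReductRule J g ≡ just rr

Model2 : ∀ {S} → Program S → Interp2 S → Interp2 S → Set
Model2 P J M = ∀ rr → InGL P J rr → All (λ a → M a ≡ true) (glPos rr) → M (glHead rr) ≡ true

IsFP : ∀ {S} → Program S → Interp2 S → Interp2 S → Set
IsFP {S} P J K = Model2 P J K × (∀ (M : Interp2 S) → Model2 P J M → ∀ a → K a ≡ true → M a ≡ true)

InBox : ∀ {S} → Interp3 S → Interp2 S → Set
InBox I J = ∀ a → (I a ≡ 𝟙 → J a ≡ true) × (I a ≡ 𝟘 → J a ≡ false)

StableTrapSet : ∀ {S} → Program S → (Interp2 S → Set) → Set
StableTrapSet {S} P T = (Σ (Interp2 S) T) × (∀ J K → T J → IsFP P J K → T K)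

StableTrapSpace : ∀ {S} → Program S → Interp3 S → Set
StableTrapSpace P I = StableTrapSet P (InBox I)

MinStableTrapSpace : ∀ {S} → Program S → Interp3 S → Set
MinStableTrapSpace {S} P I =
  StableTrapSpace P I × ¬ (Σ (Interp3 S) λ J → StableTrapSpace P J × UStrict J I)

-- Read a three-valued I as the pair of two-valued sets lower I (true atoms) ⊆ upper I
-- (non-false atoms), so that [I] is the interval between them. The three-valued reduct P^I
-- splits into the Gelfond–Lifschitz reducts P^(upper I), which governs lower bounds, and
-- P^(lower I), which governs upper bounds; a stable partial model is thus a pair with
-- lower I = F_P(upper I) and upper I = F_P(lower I). As F_P is antitone, it then maps [I]
-- into itself, so I is a stable trap space. Conversely, F_P maps the interval of a stable
-- trap space I into itself, and the least fixpoint L of F_P ∘ F_P there yields the stable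
-- partial model with bounds L ⊆ F_P(L), which refines I. Refining shrinks the undefined part,
-- so ≤_u-minimality means the same among stable partial models and among stable trap spaces.
module Submission where

open import Defs
open import Level using (0ℓ)
open import Axiom.ExcludedMiddle using (ExcludedMiddle)
open import Function.Bundles using (_⇔_; mk⇔)
open import Function.Base using (_∘_)
open import Data.Nat using (z≤n; s≤s)
open import Data.Bool using (Bool; true; false; if_then_else_)
open import Data.Bool.ListAction using (any)
open import Data.List using (List; []; _∷_; map; _++_; filterᵇ)
open import Data.List.Relation.Unary.All as All using (All; []; _∷_)
open import Data.Maybe using (just; nothing)
open import Data.Product using (Σ; _×_; _,_; proj₁; proj₂)
open import Relation.Nullary using (Dec; yes; does)
open import Relation.Nullary.Decidable using (dec-true; decidable-stable)
open import Relation.Binary.PropositionalEquality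
  using (_≡_; refl; sym; trans; cong; _≗_)

private
  variable
    A : Set

infix 4 _⊆ᵇ_

_⊆ᵇ_ : (A → Bool) → (A → Bool) → Set
X ⊆ᵇ Y = ∀ a → X a ≡ true → Y a ≡ true

⊆ᵇ-refl : {X : A → Bool} → X ⊆ᵇ X
⊆ᵇ-refl _ e = e

⊆ᵇ-trans : {X Y Z : A → Bool} → X ⊆ᵇ Y → Y ⊆ᵇ Z → X ⊆ᵇ Z
⊆ᵇ-trans X⊆Y Y⊆Z a = Y⊆Z a ∘ X⊆Y a

⊆ᵇ-antisym : {X Y : A → Bool} → X ⊆ᵇ Y → Y ⊆ᵇ X → X ≗ Y
⊆ᵇ-antisym {X = X} {Y} X⊆Y Y⊆X a with X a in eX | Y a in eY
... | false | false = refl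
... | true  | true  = refl
... | true  | false = trans (sym (X⊆Y a eX)) eY
... | false | true  = trans (sym eX) (Y⊆X a eY)

≗⇒⊆ᵇ : {X Y : A → Bool} → X ≗ Y → X ⊆ᵇ Y
≗⇒⊆ᵇ X≗Y a = trans (sym (X≗Y a))

Interval : (lo hi X : A → Bool) → Set
Interval lo hi X = lo ⊆ᵇ X × X ⊆ᵇ hi

any-false-anti : {X Y : A → Bool} → X ⊆ᵇ Y → ∀ xs → any Y xs ≡ false → any X xs ≡ false
any-false-anti X⊆Y [] _ = refl
any-false-anti {X = X} {Y} X⊆Y (x ∷ xs) e with X x in eX | Y x in eY
... | false | false = any-false-anti X⊆Y xs e
... | _     | true  with () ← e
... | true  | false with () ← trans (sym (X⊆Y x eX)) eY

dec-true⁻¹ : {Q : Set} (q? : Dec Q) → does q? ≡ true → Q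
dec-true⁻¹ (yes q) _ = q

module _ (lem : ExcludedMiddle 0ℓ) (F : (A → Bool) → A → Bool)
         (F-antitone : ∀ {X Y} → X ⊆ᵇ Y → F Y ⊆ᵇ F X)
         {lo hi : A → Bool} (lo⊆hi : lo ⊆ᵇ hi)
         (F-closed : ∀ {X} → Interval lo hi X → Interval lo hi (F X)) where

  private
    G : (A → Bool) → A → Bool
    G X = F (F X)

    G-monotone : ∀ {X Y} → X ⊆ᵇ Y → G X ⊆ᵇ G Y
    G-monotone = F-antitone ∘ F-antitone

    PreFixed : (A → Bool) → Set
    PreFixed X = Interval lo hi X × G X ⊆ᵇ X

    L : A → Bool
    L a = does (lem {∀ X → PreFixed X → X a ≡ true})

    L-lowerBound : ∀ {X} → PreFixed X → L ⊆ᵇ X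
    L-lowerBound {X} pre a La = dec-true⁻¹ lem La X pre

    L-greatest : ∀ {Y} → (∀ X → PreFixed X → Y ⊆ᵇ X) → Y ⊆ᵇ L
    L-greatest Y⊆ a Ya = dec-true lem (λ X pre → Y⊆ X pre a Ya)

    hi-preFixed : PreFixed hi
    hi-preFixed = hi-interval , proj₂ (F-closed (F-closed hi-interval))
      where
      hi-interval : Interval lo hi hi
      hi-interval = lo⊆hi , ⊆ᵇ-refl

    L-interval : Interval lo hi L
    L-interval = L-greatest (λ X pre → proj₁ (proj₁ pre)) , L-lowerBound hi-preFixed

    GL⊆L : G L ⊆ᵇ L
    GL⊆L = L-greatest λ X pre → ⊆ᵇ-trans (G-monotone (L-lowerBound pre)) (proj₂ pre)

    L⊆GL : L ⊆ᵇ G L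
    L⊆GL = L-lowerBound (F-closed (F-closed L-interval) , G-monotone GL⊆L)

    L⊆FL : L ⊆ᵇ F L
    L⊆FL = L-lowerBound (F-closed L-interval , F-antitone L⊆GL)

  -- L is the least fixpoint of F ∘ F in the interval (Knaster–Tarski).
  antitone⇒alternatingFixpoint :
    Σ (A → Bool) λ L → Interval lo hi L × F (F L) ≗ L × L ⊆ᵇ F L
  antitone⇒alternatingFixpoint = L , L-interval , ⊆ᵇ-antisym GL⊆L L⊆GL , L⊆FL

isNonZero : V3 → Bool
isNonZero 𝟘 = false
isNonZero _ = true

lower upper : (A → V3) → A → Bool
lower I a = isOne (I a)
upper I a = isNonZero (I a)

lower⊆upper : (I : A → V3) → lower I ⊆ᵇ upper I
lower⊆upper I a e with I a
... | 𝟙 = refl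

≤t-intro : ∀ {x y} → (isOne x ≡ true → isOne y ≡ true) →
           (isNonZero x ≡ true → isNonZero y ≡ true) → x ≤t y
≤t-intro {𝟘}     _   _  = z≤n
≤t-intro {⋆} {𝟘} _   nz with () ← nz refl
≤t-intro {⋆} {⋆} _   _  = s≤s z≤n
≤t-intro {⋆} {𝟙} _   _  = s≤s z≤n
≤t-intro {𝟙} {𝟙} _   _  = s≤s (s≤s z≤n)
≤t-intro {𝟙} {𝟘} one _ with () ← one refl
≤t-intro {𝟙} {⋆} one _ with () ← one refl

≤t-isOne : ∀ {x y} → x ≤t y → isOne x ≡ true → isOne y ≡ true
≤t-isOne {𝟙} {𝟙} _ _ = refl
≤t-isOne {𝟙} {⋆} (s≤s ()) _

≤t-isNonZero : ∀ {x y} → x ≤t y → isNonZero x ≡ true → isNonZero y ≡ true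
≤t-isNonZero {⋆} {⋆} _ _ = refl
≤t-isNonZero {⋆} {𝟙} _ _ = refl
≤t-isNonZero {𝟙} {⋆} _ _ = refl
≤t-isNonZero {𝟙} {𝟙} _ _ = refl

isOne-∧₃⁺ : ∀ {x y} → isOne x ≡ true → isOne y ≡ true → isOne (x ∧₃ y) ≡ true
isOne-∧₃⁺ {𝟙} _ e = e

isOne-∧₃⁻ : ∀ x y → isOne (x ∧₃ y) ≡ true → isOne x ≡ true × isOne y ≡ true
isOne-∧₃⁻ 𝟙 y e = refl , e
isOne-∧₃⁻ ⋆ 𝟘 ()
isOne-∧₃⁻ ⋆ ⋆ ()
isOne-∧₃⁻ ⋆ 𝟙 ()

isNonZero-∧₃⁺ : ∀ {x y} → isNonZero x ≡ true → isNonZero y ≡ true →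
                isNonZero (x ∧₃ y) ≡ true
isNonZero-∧₃⁺ {⋆} {⋆} _ _ = refl
isNonZero-∧₃⁺ {⋆} {𝟙} _ _ = refl
isNonZero-∧₃⁺ {𝟙}     _ e = e

isNonZero-∧₃⁻ : ∀ x y → isNonZero (x ∧₃ y) ≡ true →
                isNonZero x ≡ true × isNonZero y ≡ true
isNonZero-∧₃⁻ ⋆ ⋆ _ = refl , refl
isNonZero-∧₃⁻ ⋆ 𝟙 _ = refl , refl
isNonZero-∧₃⁻ 𝟙 y e = refl , e

refines-⋆ : ∀ {x y} → (isOne y ≡ true → isOne x ≡ true) →
               (isNonZero x ≡ true → isNonZero y ≡ true) → x ≡ ⋆ → y ≡ ⋆
refines-⋆ {y = 𝟘} _   nz refl with () ← nz refl
refines-⋆ {y = ⋆} _   _  refl = refl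
refines-⋆ {y = 𝟙} one _  refl with () ← one refl

refines-≡ : ∀ {x y} → (isOne y ≡ true → isOne x ≡ true) →
            (isNonZero x ≡ true → isNonZero y ≡ true) → (y ≡ ⋆ → x ≡ ⋆) → x ≡ y
refines-≡ {y = ⋆}     _   _  star = star refl
refines-≡ {𝟘} {𝟘}     _   _  _    = refl
refines-≡ {𝟙} {𝟙}     _   _  _    = refl
refines-≡ {𝟘} {𝟙}     one _  _    with () ← one refl
refines-≡ {⋆} {𝟙}     one _  _    with () ← one refl
refines-≡ {⋆} {𝟘}     _   nz _    with () ← nz refl
refines-≡ {𝟙} {𝟘}     _   nz _    with () ← nz refl

Refines : (K I : A → V3) → Set
Refines K I = lower I ⊆ᵇ lower K × upper K ⊆ᵇ upper I

refines⇒USub : ∀ {S} {K I : Interp3 S} → Refines K I → USub K I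
refines⇒USub (lo , up) a = refines-⋆ (lo a) (up a)

refines⇒≗ : ∀ {S} {K I : Interp3 S} → Refines K I → USub I K → K ≗ I
refines⇒≗ (lo , up) I⊆K a = refines-≡ (lo a) (up a) (I⊆K a)

USub-UStrict-trans : ∀ {S} {K J I : Interp3 S} → USub K J → UStrict J I → UStrict K I
USub-UStrict-trans K⊆J (J⊆I , I⊈J) = (λ a → J⊆I a ∘ K⊆J a) , λ I⊆K → I⊈J (λ a → K⊆J a ∘ I⊆K a)

fromBounds : (L U : A → Bool) → A → V3
fromBounds L U a = if L a then 𝟙 else (if U a then ⋆ else 𝟘)

lower-fromBounds : (L U : A → Bool) → lower (fromBounds L U) ≗ L
lower-fromBounds L U a with L a | U a
... | true  | _     = refl
... | false | true  = refl
... | false | false = refl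

upper-fromBounds : {L U : A → Bool} → L ⊆ᵇ U → upper (fromBounds L U) ≗ U
upper-fromBounds {L = L} {U} L⊆U a with L a in eL | U a in eU
... | true  | true  = refl
... | true  | false = trans (sym (L⊆U a eL)) eU
... | false | true  = refl
... | false | false = refl

module _ {S : Signature} {M : Interp3 S} where

  body-isOne⁺ : ∀ ps (us : List (GAtom S)) →
                All (λ a → lower M a ≡ true) ps → us ≡ [] →
                isOne (evalBody M (map atm ps ++ map (λ _ → 𝐮) us)) ≡ true
  body-isOne⁺ []       [] []         refl = refl
  body-isOne⁺ (_ ∷ ps) us (one ∷ ones) us≡[] =
    isOne-∧₃⁺ one (body-isOne⁺ ps us ones us≡[])

  body-isOne⁻ : ∀ ps (us : List (GAtom S)) →
                isOne (evalBody M (map atm ps ++ map (λ _ → 𝐮) us)) ≡ true →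
                All (λ a → lower M a ≡ true) ps × us ≡ []
  body-isOne⁻ []       []      _ = [] , refl
  body-isOne⁻ []       (_ ∷ us) e with () ← proj₁ (isOne-∧₃⁻ ⋆ (evalBody M (map (λ _ → 𝐮) us)) e)
  body-isOne⁻ (a ∷ ps) us      e with isOne-∧₃⁻ (M a) _ e
  ... | one , rest with body-isOne⁻ ps us rest
  ...   | ones , us≡[] = one ∷ ones , us≡[]

  body-isNonZero⁺ : ∀ ps (us : List (GAtom S)) → All (λ a → upper M a ≡ true) ps →
                    isNonZero (evalBody M (map atm ps ++ map (λ _ → 𝐮) us)) ≡ true
  body-isNonZero⁺ []       []       []         = refl
  body-isNonZero⁺ []       (_ ∷ us) []         = isNonZero-∧₃⁺ {⋆} refl (body-isNonZero⁺ [] us [])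
  body-isNonZero⁺ (_ ∷ ps) us       (nz ∷ nzs) = isNonZero-∧₃⁺ nz (body-isNonZero⁺ ps us nzs)

  body-isNonZero⁻ : ∀ ps (us : List (GAtom S)) →
                    isNonZero (evalBody M (map atm ps ++ map (λ _ → 𝐮) us)) ≡ true →
                    All (λ a → upper M a ≡ true) ps
  body-isNonZero⁻ []       _  _ = []
  body-isNonZero⁻ (a ∷ ps) us e with isNonZero-∧₃⁻ (M a) _ e
  ... | nz , rest = nz ∷ body-isNonZero⁻ ps us rest

upper-survives⁺ : (I : A → V3) → ∀ xs → any (lower I) xs ≡ false →
                  filterᵇ (λ b → isStar (I b)) xs ≡ [] → any (upper I) xs ≡ false
upper-survives⁺ I []       _ _ = refl
upper-survives⁺ I (x ∷ xs) e f with I x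
... | 𝟘 = upper-survives⁺ I xs e f

upper-survives⁻ : (I : A → V3) → ∀ xs → any (upper I) xs ≡ false →
                  any (lower I) xs ≡ false × filterᵇ (λ b → isStar (I b)) xs ≡ []
upper-survives⁻ I []       _ = refl , refl
upper-survives⁻ I (x ∷ xs) e with I x
... | 𝟘 = upper-survives⁻ I xs e

guard-just : ∀ {B : Set} b {x y : B} → (if b then nothing else just x) ≡ just y → b ≡ false × x ≡ y
guard-just false refl = refl , refl

guard-false : ∀ {B : Set} {b} {x : B} → b ≡ false → (if b then nothing else just x) ≡ just x
guard-false refl = refl

module _ {S : Signature} (P : Program S) where

  reductBody : Interp3 S → GroundRule S → List (BodyElem S)
  reductBody I g = map atm (gPos g) ++ map (λ _ → 𝐮) (filterᵇ (λ b → isStar (I b)) (gNeg g))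

  Model2-rule : ∀ {J M g} → Model2 P J M → InGr P g → any J (gNeg g) ≡ false →
                All (λ a → M a ≡ true) (gPos g) → M (gHead g) ≡ true
  Model2-rule m g∈P survives = m _ (_ , g∈P , guard-false survives)

  Model2-byRules : ∀ {J M} →
    (∀ {g} → InGr P g → any J (gNeg g) ≡ false →
             All (λ a → M a ≡ true) (gPos g) → M (gHead g) ≡ true) →
    Model2 P J M
  Model2-byRules {J} closed _ (g , g∈P , reduct≡) with guard-just (any J (gNeg g)) reduct≡
  ... | survives , refl = closed g∈P survives

  Model3-rule : ∀ {I M g} → Model3 P I M → InGr P g → any (lower I) (gNeg g) ≡ false →
                evalBody M (reductBody I g) ≤t M (gHead g)
  Model3-rule m g∈P survives = m _ (_ , g∈P , guard-false survives)

  Model3-byRules : ∀ {I M} →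
    (∀ {g} → InGr P g → any (lower I) (gNeg g) ≡ false →
             evalBody M (reductBody I g) ≤t M (gHead g)) →
    Model3 P I M
  Model3-byRules {I} closed _ (g , g∈P , reduct≡) with guard-just (any (lower I) (gNeg g)) reduct≡
  ... | survives , refl = closed g∈P survives

  Model3⇒Model2-lower : ∀ {I M} → Model3 P I M → Model2 P (upper I) (lower M)
  Model3⇒Model2-lower {I} m = Model2-byRules λ {g} g∈P survives ones →
    let survivesˡ , noStars = upper-survives⁻ I (gNeg g) survives
    in ≤t-isOne (Model3-rule m g∈P survivesˡ) (body-isOne⁺ (gPos g) _ ones noStars)

  Model3⇒Model2-upper : ∀ {I M} → Model3 P I M → Model2 P (lower I) (upper M)
  Model3⇒Model2-upper m = Model2-byRules λ {g} g∈P survives nzs →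
    ≤t-isNonZero (Model3-rule m g∈P survives) (body-isNonZero⁺ (gPos g) _ nzs)

  Model2s⇒Model3 : ∀ {I M} → Model2 P (upper I) (lower M) → Model2 P (lower I) (upper M) →
                   Model3 P I M
  Model2s⇒Model3 {I} mˡ mᵘ = Model3-byRules λ {g} g∈P survives → ≤t-intro
    (λ one → let ones , noStars = body-isOne⁻ (gPos g) _ one
             in Model2-rule mˡ g∈P (upper-survives⁺ I (gNeg g) survives noStars) ones)
    (λ nz → Model2-rule mᵘ g∈P survives (body-isNonZero⁻ (gPos g) _ nz))

  Model2-anti : ∀ {J J′ M} → J ⊆ᵇ J′ → Model2 P J M → Model2 P J′ M
  Model2-anti J⊆J′ m = Model2-byRules λ {g} g∈P survives →
    Model2-rule m g∈P (any-false-anti J⊆J′ (gNeg g) survives)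

  Model2-resp : ∀ {J M M′} → M ≗ M′ → Model2 P J M → Model2 P J M′
  Model2-resp M≗M′ m = Model2-byRules λ {g} g∈P survives ones →
    ≗⇒⊆ᵇ M≗M′ (gHead g) (Model2-rule m g∈P survives (All.map (λ {a} → ≗⇒⊆ᵇ (sym ∘ M≗M′) a) ones))

  IsFP-resp : ∀ {J J′ K K′} → J ≗ J′ → K ≗ K′ → IsFP P J K → IsFP P J′ K′
  IsFP-resp J≗J′ K≗K′ (m , least) =
    Model2-resp K≗K′ (Model2-anti (≗⇒⊆ᵇ J≗J′) m) ,
    λ M mM → ⊆ᵇ-trans (≗⇒⊆ᵇ (sym ∘ K≗K′)) (least M (Model2-anti (≗⇒⊆ᵇ (sym ∘ J≗J′)) mM))

  IsAlternatingFixpoint : Interp3 S → Set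
  IsAlternatingFixpoint I = IsFP P (upper I) (lower I) × IsFP P (lower I) (upper I)

  alternatingFixpoint⇒stablePartial : ∀ {I} → IsAlternatingFixpoint I → StablePartial P I
  alternatingFixpoint⇒stablePartial ((mˡ , leastˡ) , (mᵘ , leastᵘ)) =
    Model2s⇒Model3 mˡ mᵘ ,
    λ M m a → ≤t-intro (leastˡ (lower M) (Model3⇒Model2-lower m) a)
                       (leastᵘ (upper M) (Model3⇒Model2-upper m) a)

  IsAlternatingFixpoint-resp : ∀ {I I′} → I ≗ I′ →
                               IsAlternatingFixpoint I → IsAlternatingFixpoint I′
  IsAlternatingFixpoint-resp {I} {I′} I≗I′ (fpˡ , fpᵘ) =
    IsFP-resp upper≗ lower≗ fpˡ , IsFP-resp lower≗ upper≗ fpᵘ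
    where
    lower≗ : lower I ≗ lower I′
    lower≗ = cong isOne ∘ I≗I′
    upper≗ : upper I ≗ upper I′
    upper≗ = cong isNonZero ∘ I≗I′

  -- Test against the model of P^I that is true on X and undefined elsewhere.
  stablePartial-lowerLeast : ∀ {I X} → StablePartial P I → Model2 P (upper I) X → lower I ⊆ᵇ X
  stablePartial-lowerLeast {I} {X} (_ , least) mX a one =
    ≗⇒⊆ᵇ (lower-fromBounds X everything) a (≤t-isOne (least M model a) one)
    where
    everything : Interp2 S
    everything _ = true
    M : Interp3 S
    M = fromBounds X everything
    model : Model3 P I M
    model = Model2s⇒Model3 (Model2-resp (sym ∘ lower-fromBounds X everything) mX)
                           (Model2-resp (sym ∘ upper-fromBounds (λ _ _ → refl)) λ _ _ _ → refl)

  inBox⁻ : ∀ {I : Interp3 S} {X} → InBox I X → Interval (lower I) (upper I) X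
  inBox⁻ {I} {X} X∈I = lo , up
    where
    lo : lower I ⊆ᵇ X
    lo a one with I a in e
    ... | 𝟙 = proj₁ (X∈I a) e
    up : X ⊆ᵇ upper I
    up a Xa with I a in e
    ... | 𝟘 with () ← trans (sym Xa) (proj₂ (X∈I a) e)
    ... | ⋆ = refl
    ... | 𝟙 = refl

  inBox⁺ : ∀ {I : Interp3 S} {X} → Interval (lower I) (upper I) X → InBox I X
  inBox⁺ {I} {X} (lo , up) a = (λ e → lo a (cong isOne e)) , zero
    where
    zero : I a ≡ 𝟘 → X a ≡ false
    zero e with X a in eX
    ... | false = refl
    ... | true with () ← trans (sym (up a eX)) (cong isNonZero e)

  stablePartial⇒stableTrapSpace : ∀ {I : Interp3 S} → StablePartial P I → StableTrapSpace P I
  stablePartial⇒stableTrapSpace {I} sp@(m , _) =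
    (lower I , inBox⁺ (⊆ᵇ-refl , lower⊆upper I)) ,
    λ J K J∈I (mK , leastK) → let lo⊆J , J⊆up = inBox⁻ J∈I in
      inBox⁺ ( stablePartial-lowerLeast sp (Model2-anti J⊆up mK)
             , leastK (upper I) (Model2-anti lo⊆J (Model3⇒Model2-upper m)))

  module _ (lem : ExcludedMiddle 0ℓ) where

    F : Interp2 S → Interp2 S
    F J a = does (lem {∀ M → Model2 P J M → M a ≡ true})

    F-isFP : ∀ J → IsFP P J (F J)
    F-isFP J = model , λ M mM a Fa → dec-true⁻¹ lem Fa M mM
      where
      model : Model2 P J (F J)
      model = Model2-byRules λ g∈P survives Fs → dec-true lem λ M mM →
        Model2-rule mM g∈P survives (All.map (λ {a} Fa → dec-true⁻¹ lem Fa M mM) Fs)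

    F-antitone : ∀ {J J′} → J ⊆ᵇ J′ → F J′ ⊆ᵇ F J
    F-antitone {J} {J′} J⊆J′ = proj₂ (F-isFP J′) (F J) (Model2-anti J⊆J′ (proj₁ (F-isFP J)))

    alternatingFixpoint-fromBounds : ∀ {L} → F (F L) ≗ L → L ⊆ᵇ F L →
                                     IsAlternatingFixpoint (fromBounds L (F L))
    alternatingFixpoint-fromBounds {L} FFL≗L L⊆FL =
      IsFP-resp (sym ∘ upper≗) (λ a → trans (FFL≗L a) (sym (lower≗ a))) (F-isFP (F L)) ,
      IsFP-resp (sym ∘ lower≗) (sym ∘ upper≗) (F-isFP L)
      where
      lower≗ : lower (fromBounds L (F L)) ≗ L
      lower≗ = lower-fromBounds L (F L)
      upper≗ : upper (fromBounds L (F L)) ≗ F L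
      upper≗ = upper-fromBounds L⊆FL

    stableTrapSpace-F-closed : ∀ {I : Interp3 S} → StableTrapSpace P I → ∀ {X} →
      Interval (lower I) (upper I) X → Interval (lower I) (upper I) (F X)
    stableTrapSpace-F-closed (_ , trap) {X} X∈I = inBox⁻ (trap X (F X) (inBox⁺ X∈I) (F-isFP X))

    stableTrapSpace⇒alternatingFixpoint : ∀ {I : Interp3 S} → StableTrapSpace P I →
      Σ (Interp3 S) λ K → IsAlternatingFixpoint K × Refines K I
    stableTrapSpace⇒alternatingFixpoint {I} trapI
      with antitone⇒alternatingFixpoint lem F F-antitone (lower⊆upper I)
                                        (stableTrapSpace-F-closed trapI)
    ... | L , L∈I@(lo⊆L , _) , FFL≗L , L⊆FL =
      fromBounds L (F L) ,
      alternatingFixpoint-fromBounds FFL≗L L⊆FL ,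
      ( ⊆ᵇ-trans lo⊆L (≗⇒⊆ᵇ (sym ∘ lower-fromBounds L (F L)))
      , ⊆ᵇ-trans (≗⇒⊆ᵇ (upper-fromBounds L⊆FL)) (proj₂ (stableTrapSpace-F-closed trapI L∈I)))

theorem4p10 : ExcludedMiddle 0ℓ →
    (S : Signature) (P : Program S) (I : Interp3 S) →
    LStable P I ⇔ MinStableTrapSpace P I
theorem4p10 lem S P I = mk⇔ lStable⇒minimal minimal⇒lStable
  where
  lStable⇒minimal : LStable P I → MinStableTrapSpace P I
  lStable⇒minimal (spI , noSmallerSP) =
    stablePartial⇒stableTrapSpace P spI ,
    λ (J , trapJ , J<I) →
      let K , altK , K⊑J = stableTrapSpace⇒alternatingFixpoint P lem trapJ
      in noSmallerSP (K , alternatingFixpoint⇒stablePartial P altK ,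
                      USub-UStrict-trans (refines⇒USub K⊑J) J<I)

  minimal⇒lStable : MinStableTrapSpace P I → LStable P I
  minimal⇒lStable (trapI , noSmallerTrap) with stableTrapSpace⇒alternatingFixpoint P lem trapI
  ... | K , altK , K⊑I =
    alternatingFixpoint⇒stablePartial P (IsAlternatingFixpoint-resp P (refines⇒≗ K⊑I I⊆K) altK) ,
    λ (J , spJ , J<I) → noSmallerTrap (J , stablePartial⇒stableTrapSpace P spJ , J<I)
    where
    I⊆K : USub I K
    I⊆K = decidable-stable lem λ I⊈K →
      noSmallerTrap ( K
                    , stablePartial⇒stableTrapSpace P (alternatingFixpoint⇒stablePartial P altK)
                    , refines⇒USub K⊑I , I⊈K)
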